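{- The canonical model $\mathcal{M}^c=(W^c,\sim^c,V^c)$ for $\mathsf{Syn}$ is a proper $\kappa$-model.
   Context: Fix a finite set $\mathsf{Ag}$ of agents; an agent pattern is a set $G\subseteq\mathcal{P}(\mathsf{Ag})\setminus\{\emptyset\}$. Formulas: $\varphi::= p\mid\neg\varphi\mid\varphi\wedge\varphi\mid [G]\varphi$ ($p$ in a countable set $\mathsf{Prop}$); $\bot:=p\wedge\neg p$ for fixed $p$; $\mathsf{alive}(G):=\neg[G]\bot$; $G^C:=\{H\in\mathcal{P}(\mathsf{Ag})\setminus\{\emptyset\}\mid\neg\exists B\in G.\ H\subseteq B\}$; $\mathsf{dead}(G):=\bigwedge_{B\in G}\neg\mathsf{alive}(\{B\})$. $\mathsf{Syn}$: all propositional tautologies; (K) $[G](\varphi\to\psi)\to([G]\varphi\to[G]\psi)$; (B) $\varphi\to[G]\neg[G]\neg\varphi$; (4) $[G]\varphi\to[G][G]\varphi$; (T) $\mathsf{alive}(G)\to([G]\varphi\to\varphi)$; (P) $\mathsf{alive}(G)\wedge\mathsf{dead}(G^C)\wedge\varphi\to[G](\mathsf{dead}(G^C)\to\varphi)$; (NE) $\bigvee_G\mathsf{alive}(G)$; (Mono) $[G]\varphi\to[H]\varphi$ if $G\subseteq H$; (Equiv) $[G\cup\{B\}]\varphi\to[G]\varphi$ if some $A\in G$ has $\emptyset\ne B\subseteq A$; (Union) $\mathsf{alive}(G)\wedge\mathsf{alive}(H)\to\mathsf{alive}(G\cup H)$; (Clo) $\mathsf{alive}(G)\to\mathsf{alive}(\{A\cup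 B\})$ for $A,B\in G$; rules modus ponens and $[G]$-necessitation. A set $\Gamma$ of formulas is consistent if $\Gamma\not\vdash\bot$ in $\mathsf{Syn}$, and maximal consistent if no proper superset is consistent. Canonical model: $W^c$ is the set of maximal consistent sets; $\Gamma\sim^c_G\Delta$ iff $\{\varphi\mid[G]\varphi\in\Gamma\}\subseteq\Delta$; $\Gamma\in V^c(p)$ iff $p\in\Gamma$. A pre-model $\mathcal{M}=(W,\sim,V)$: $W$ a set, $\sim_G$ a symmetric transitive relation on $W$ for each agent pattern $G$, $V$ a valuation. $\mathsf{alive}(G)_\mathcal{M}=\{w\mid w\sim_G w\}$. A $\kappa$-model is a pre-model with, for all agent patterns $G,H$: (K1) $\mathsf{alive}(G)_\mathcal{M}\cap\mathsf{alive}(H)_\mathcal{M}\subseteq\mathsf{alive}(G\cup H)_\mathcal{M}$; (K2) $\mathsf{alive}(G)_\mathcal{M}\subseteq\mathsf{alive}(\{A\cup B\})_\mathcal{M}$ for $A,B\in G$; (K3) $\sim_H\subseteq\sim_G$ if $G\subseteq H$; (K4) $\sim_G\subseteq\sim_{G\cup\{B\}}$ if some $A\in G$ has $\emptyset\ne B\subseteq A$; (NE) every $w$ has some $G$ with $w\sim_G w$. For $w\in W$ let $\overline{w}=\{B\mid\exists G.\ B\in G\text{ and }w\in\mathsf{alive}(G)_\mathcal{M}\}$. Define $w\equiv v$ iff $\overline{w}=\overline{v}$ and $w\sim_{\overline{w}}v$. $\mathcal{M}$ is proper iff $w\equiv v$ implies $w=v$. -}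

module Defs where

open import Data.Nat using (ℕ; zero; suc)
open import Data.Bool using (Bool; true; false; _∧_; _∨_; not; if_then_else_)
open import Data.Unit using (⊤; tt)
open import Data.Product using (Σ; _×_; _,_; ∃; ∃-syntax; proj₁)
open import Data.Sum using (_⊎_)
open import Data.Empty using (⊥)
open import Data.List using (List; []; _∷_; map; _++_; foldr; filterᵇ; concatMap)
open import Data.List.Relation.Unary.All using (All)
open import Data.Vec using (Vec; []; _∷_)
open import Data.Vec.Properties using (≡-dec)
import Data.Bool.Properties as BoolP
open import Data.Fin.Subset using (Subset; _⊆_; Nonempty) renaming (_∪_ to _∪ˢ_)
open import Data.Fin.Subset.Properties using (_⊆?_)
open import Relation.Nullary using (¬_)
open import Relation.Nullary.Decidable using (⌊_⌋)
open import Relation.Binary.PropositionalEquality using (_≡_)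

-- Agents: Ag = Fin n.  Subsets of Ag: Data.Fin.Subset (Vec Bool n).

allSub : (n : ℕ) → List (Subset n)
allSub zero = [] ∷ []
allSub (suc n) = map (false ∷_) (allSub n) ++ map (true ∷_) (allSub n)

_==ˢ_ : ∀ {n} → Subset n → Subset n → Bool
A ==ˢ B = ⌊ ≡-dec BoolP._≟_ A B ⌋

_⊆ᵇ_ : ∀ {n} → Subset n → Subset n → Bool
A ⊆ᵇ B = ⌊ A ⊆? B ⌋

-- Agent patterns: sets of NONEMPTY subsets of Fin n, in a canonical
-- (extensional) representation.
--   Tbl n     : a Boolean table indexed by all subsets of Fin n
--   Pattern n : a Boolean table indexed by all nonempty subsets of Fin n

Tbl : ℕ → Set
Tbl zero = Bool
Tbl (suc n) = Tbl n × Tbl n   -- (first agent absent , first agent present)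

lookupT : ∀ {n} → Tbl n → Subset n → Bool
lookupT {zero} b [] = b
lookupT {suc n} (f , t) (false ∷ s) = lookupT f s
lookupT {suc n} (f , t) (true ∷ s) = lookupT t s

tabT : ∀ {n} → (Subset n → Bool) → Tbl n
tabT {zero} P = P []
tabT {suc n} P = tabT (λ s → P (false ∷ s)) , tabT (λ s → P (true ∷ s))

Pattern : ℕ → Set
Pattern zero = ⊤
Pattern (suc n) = Pattern n × Tbl n
  -- (nonempty subsets without the first agent , subsets with the first agent)

-- membership B ∈ G (the empty subset is never a member)
memP : ∀ {n} → Pattern n → Subset n → Bool
memP {zero} tt [] = false
memP {suc n} (g , t) (false ∷ s) = memP g s
memP {suc n} (g , t) (true ∷ s) = lookupT t s

_∈ᴾ_ : ∀ {n} → Subset n → Pattern n → Set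
B ∈ᴾ G = memP G B ≡ true

tabP : ∀ {n} → (Subset n → Bool) → Pattern n
tabP {zero} P = tt
tabP {suc n} P = tabP (λ s → P (false ∷ s)) , tabT (λ s → P (true ∷ s))

allTbl : (n : ℕ) → List (Tbl n)
allTbl zero = false ∷ true ∷ []
allTbl (suc n) = concatMap (λ f → map (f ,_) (allTbl n)) (allTbl n)

allPat : (n : ℕ) → List (Pattern n)
allPat zero = tt ∷ []
allPat (suc n) = concatMap (λ g → map (g ,_) (allTbl n)) (allPat n)

_∪ᴾ_ : ∀ {n} → Pattern n → Pattern n → Pattern n
G ∪ᴾ H = tabP (λ B → memP G B ∨ memP H B)

-- singleton pattern {B} (used only for nonempty B)
sing : ∀ {n} → Subset n → Pattern n
sing B = tabP (λ C → C ==ˢ B)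

compl : ∀ {n} → Pattern n → Pattern n
compl {n} G = tabP (λ H → not (foldr (λ B r → (memP G B ∧ (H ⊆ᵇ B)) ∨ r) false (allSub n)))

_⊆ᴾ_ : ∀ {n} → Pattern n → Pattern n → Set
G ⊆ᴾ H = ∀ B → B ∈ᴾ G → B ∈ᴾ H

elems : ∀ {n} → Pattern n → List (Subset n)
elems {n} G = filterᵇ (memP G) (allSub n)

data Formula (n : ℕ) : Set where
  var : ℕ → Formula n
  ¬ᶠ_ : Formula n → Formula n
  _∧ᶠ_ : Formula n → Formula n → Formula n
  [_]_ : Pattern n → Formula n → Formula n

infix 30 ¬ᶠ_
infixr 25 _∧ᶠ_
infix 30 [_]_

module _ {n : ℕ} where

  infixr 22 _∨ᶠ_
  infixr 20 _⇒_

  ⊥ᶠ : Formula n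
  ⊥ᶠ = var 0 ∧ᶠ ¬ᶠ var 0

  ⊤ᶠ : Formula n
  ⊤ᶠ = ¬ᶠ ⊥ᶠ

  _∨ᶠ_ : Formula n → Formula n → Formula n
  φ ∨ᶠ ψ = ¬ᶠ (¬ᶠ φ ∧ᶠ ¬ᶠ ψ)

  _⇒_ : Formula n → Formula n → Formula n
  φ ⇒ ψ = ¬ᶠ (φ ∧ᶠ ¬ᶠ ψ)

  ⋀ : List (Formula n) → Formula n
  ⋀ = foldr _∧ᶠ_ ⊤ᶠ

  ⋁ : List (Formula n) → Formula n
  ⋁ = foldr _∨ᶠ_ ⊥ᶠ

  alive : Pattern n → Formula n
  alive G = ¬ᶠ ([ G ] ⊥ᶠ)

  dead : Pattern n → Formula n
  dead G = ⋀ (map (λ B → ¬ᶠ alive (sing B)) (elems G))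

  -- propositional tautologies: true under every Boolean assignment to
  -- the atoms and to the boxed subformulas
  eval : (Formula n → Bool) → Formula n → Bool
  eval v (var p) = v (var p)
  eval v (¬ᶠ φ) = not (eval v φ)
  eval v (φ ∧ᶠ ψ) = eval v φ ∧ eval v ψ
  eval v ([ G ] φ) = v ([ G ] φ)

  Tautology : Formula n → Set
  Tautology φ = ∀ (v : Formula n → Bool) → eval v φ ≡ true

data ⊢_ {n : ℕ} : Formula n → Set where
  taut   : ∀ {φ} → Tautology φ → ⊢ φ
  axK    : ∀ {G φ ψ} → ⊢ ([ G ] (φ ⇒ ψ) ⇒ ([ G ] φ ⇒ [ G ] ψ))
  axB    : ∀ {G φ} → ⊢ (φ ⇒ [ G ] ¬ᶠ [ G ] ¬ᶠ φ)
  ax4    : ∀ {G φ} → ⊢ ([ G ] φ ⇒ [ G ] [ G ] φ)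
  axT    : ∀ {G φ} → ⊢ (alive G ⇒ ([ G ] φ ⇒ φ))
  axP    : ∀ {G φ} → ⊢ ((alive G ∧ᶠ dead (compl G) ∧ᶠ φ) ⇒ [ G ] (dead (compl G) ⇒ φ))
  axNE   : ⊢ ⋁ (map alive (allPat n))
  axMono : ∀ {G H φ} → G ⊆ᴾ H → ⊢ ([ G ] φ ⇒ [ H ] φ)
  axEquiv : ∀ {G A B φ} → A ∈ᴾ G → Nonempty B → B ⊆ A →
            ⊢ ([ G ∪ᴾ sing B ] φ ⇒ [ G ] φ)
  axUnion : ∀ {G H} → ⊢ ((alive G ∧ᶠ alive H) ⇒ alive (G ∪ᴾ H))
  axClo  : ∀ {G A B} → A ∈ᴾ G → B ∈ᴾ G → ⊢ (alive G ⇒ alive (sing (A ∪ˢ B)))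
  mp     : ∀ {φ ψ} → ⊢ (φ ⇒ ψ) → ⊢ φ → ⊢ ψ
  nec    : ∀ {G φ} → ⊢ φ → ⊢ ([ G ] φ)

infix 5 ⊢_

FSet : ℕ → Set
FSet n = Formula n → Bool

module _ {n : ℕ} where

  _∈ᶠ_ : Formula n → FSet n → Set
  φ ∈ᶠ Γ = Γ φ ≡ true

  _⊆ᶠ_ : FSet n → FSet n → Set
  Γ ⊆ᶠ Δ = ∀ φ → φ ∈ᶠ Γ → φ ∈ᶠ Δ

  _⊢ˢ_ : FSet n → Formula n → Set
  Γ ⊢ˢ φ = Σ (List (Formula n)) λ L → All (_∈ᶠ Γ) L × (⊢ (⋀ L ⇒ φ))

  Consistent : FSet n → Set
  Consistent Γ = ¬ (Γ ⊢ˢ ⊥ᶠ)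

  MaxConsistent : FSet n → Set
  MaxConsistent Γ = Consistent Γ ×
    (∀ Δ → Γ ⊆ᶠ Δ → Consistent Δ → ¬ (∃[ φ ] (φ ∈ᶠ Δ × ¬ (φ ∈ᶠ Γ))))

-- Pre-models, κ-models, properness.
-- W carries an equality _≈_ (propositional equality for ordinary models,
-- extensional equality of formula sets for the canonical model).

record Frame (n : ℕ) : Set₁ where
  field
    W   : Set
    _≈_ : W → W → Set
    R   : Pattern n → W → W → Set
    V   : ℕ → W → Set

module _ {n : ℕ} (M : Frame n) where
  open Frame M

  Alive : Pattern n → W → Set
  Alive G w = R G w w

  record IsPreModel : Set where
    field
      sym   : ∀ G {w v} → R G w v → R G v w
      trans : ∀ G {w v u} → R G w v → R G v u → R G w u

  record IsKappaModel : Set where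
    field
      preModel : IsPreModel
      K1 : ∀ G H w → Alive G w → Alive H w → Alive (G ∪ᴾ H) w
      K2 : ∀ G A B → A ∈ᴾ G → B ∈ᴾ G → ∀ w → Alive G w → Alive (sing (A ∪ˢ B)) w
      K3 : ∀ G H → G ⊆ᴾ H → ∀ w v → R H w v → R G w v
      K4 : ∀ G A B → A ∈ᴾ G → Nonempty B → B ⊆ A →
           ∀ w v → R G w v → R (G ∪ᴾ sing B) w v
      NE : ∀ w → ∃[ G ] Alive G w

  IsBar : Pattern n → W → Set
  IsBar P w = ∀ B → (B ∈ᴾ P → ∃[ G ] (B ∈ᴾ G × Alive G w))
                  × (∃[ G ] (B ∈ᴾ G × Alive G w) → B ∈ᴾ P)

  Equiv : W → W → Set
  Equiv w v = ∃[ P ] (IsBar P w × IsBar P v × R P w v)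

  IsProper : Set
  IsProper = ∀ w v → Equiv w v → w ≈ v

canonical : (n : ℕ) → Frame n
canonical n = record
  { W   = Σ (FSet n) MaxConsistent
  ; _≈_ = λ Γ Δ → ∀ φ → proj₁ Γ φ ≡ proj₁ Δ φ
  ; R   = λ G Γ Δ → ∀ φ → ([ G ] φ) ∈ᶠ proj₁ Γ → φ ∈ᶠ proj₁ Δ
  ; V   = λ p Γ → var p ∈ᶠ proj₁ Γ
  }

-- Each κ-model condition of the canonical model is the canonical reading of one axiom:
-- symmetry and transitivity of ∼_G come from B and 4, K1 from Union, K2 from Clo, K3 from
-- Mono, K4 from Equiv and NE from NE. For properness let P = w̄ = v̄ with w ∼_P v. The
-- finitely many patterns witnessing w̄ join into one alive pattern by K1 (NE covering the
-- empty join), so P is alive at w by K3; and every B ∈ Pᶜ is dead at w and at v, for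
-- otherwise B would lie in w̄ = P. Axiom P thus sends φ ∈ w to [P](dead(Pᶜ) → φ) ∈ w, hence
-- dead(Pᶜ) → φ ∈ v and φ ∈ v; by symmetry w and v contain the same formulas.

module Submission where

open import Defs
open import Data.Nat using (ℕ; zero; suc)
import Data.Nat.Properties as ℕ
open import Data.Product using (_×_; _,_; proj₁; proj₂; ∃-syntax)
import Data.Product.Properties as Product
open import Data.Sum using (_⊎_; inj₁; inj₂)
open import Data.Empty using (⊥-elim)
open import Data.Unit using (tt)
import Data.Unit.Properties as Unit
open import Data.Bool using (Bool; true; false; T; T?; _∧_; _∨_; not)
open import Data.Bool.Properties using (T-∧; T-≡; ⇔→≡; ∨-zeroʳ) renaming (_≟_ to _≟ᵇ_)
open import Data.List using ([]; _∷_; _++_; map; foldr)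
open import Data.List.Relation.Unary.All as All using (All; []; _∷_)
import Data.List.Relation.Unary.All.Properties as All
open import Data.List.Relation.Unary.Any using (Any; here; there; satisfied)
import Data.List.Relation.Unary.Any.Properties as Any
open import Data.List.Membership.Propositional using (_∈_)
open import Data.List.Membership.Propositional.Properties using (∈-map⁺; ∈-++⁺ˡ; ∈-++⁺ʳ; ∈-filter⁺)
open import Data.Vec using ([]; _∷_)
open import Data.Vec.Properties using (≡-dec)
open import Data.Vec.Base using () renaming (here to hereᵛ; there to thereᵛ)
open import Data.Fin using (zero; suc)
open import Data.Fin.Subset using (Subset; Nonempty)
open import Data.Fin.Subset.Properties using (_⊆?_; ⊆-refl)
open import Function using (id; _∘_; _⇔_; mk⇔; Equivalence)
open Equivalence using (to; from)
open import Function.Properties.Equivalence as ⇔ using ()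
open import Data.Product.Function.NonDependent.Propositional using (_×-⇔_)
open import Relation.Nullary using (¬_; Dec; yes; no)
open import Relation.Nullary.Decidable using (⌊_⌋; fromWitness; decidable-stable)
open import Relation.Binary.Definitions using (DecidableEquality)
open import Relation.Binary.PropositionalEquality using (_≡_; refl; sym; trans; cong)

T-not : ∀ b → T (not b) ⇔ (¬ T b)
T-not true  = mk⇔ (λ ()) (λ ¬T → ¬T tt)
T-not false = mk⇔ (λ _ ()) (λ _ → tt)

⌊⌋-true : ∀ {A : Set} (a? : Dec A) → A → ⌊ a? ⌋ ≡ true
⌊⌋-true a? a = to T-≡ (fromWitness {a? = a?} a)

foldr-∨-true : ∀ {A : Set} (g : A → Bool) {x xs} → x ∈ xs → g x ≡ true →
               foldr (λ y b → g y ∨ b) false xs ≡ true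
foldr-∨-true g (here refl) gx≡true rewrite gx≡true = refl
foldr-∨-true g {xs = y ∷ _} (there x∈xs) gx≡true rewrite foldr-∨-true g x∈xs gx≡true = ∨-zeroʳ (g y)

_≟ᵀ_ : ∀ {n} → DecidableEquality (Tbl n)
_≟ᵀ_ {zero}  = _≟ᵇ_
_≟ᵀ_ {suc n} = Product.≡-dec _≟ᵀ_ _≟ᵀ_

_≟ᴾ_ : ∀ {n} → DecidableEquality (Pattern n)
_≟ᴾ_ {zero}  = Unit._≟_
_≟ᴾ_ {suc n} = Product.≡-dec _≟ᴾ_ _≟ᵀ_

_≟ᶠ_ : ∀ {n} → DecidableEquality (Formula n)
var p ≟ᶠ var q with p ℕ.≟ q
... | yes refl = yes refl
... | no p≢q   = no λ { refl → p≢q refl }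
(¬ᶠ φ) ≟ᶠ (¬ᶠ ψ) with φ ≟ᶠ ψ
... | yes refl = yes refl
... | no φ≢ψ   = no λ { refl → φ≢ψ refl }
(φ ∧ᶠ ψ) ≟ᶠ (φ′ ∧ᶠ ψ′) with φ ≟ᶠ φ′ | ψ ≟ᶠ ψ′
... | yes refl | yes refl = yes refl
... | no φ≢φ′  | _        = no λ { refl → φ≢φ′ refl }
... | yes _    | no ψ≢ψ′  = no λ { refl → ψ≢ψ′ refl }
([ G ] φ) ≟ᶠ ([ H ] ψ) with G ≟ᴾ H | φ ≟ᶠ ψ
... | yes refl | yes refl = yes refl
... | no G≢H   | _        = no λ { refl → G≢H refl }
... | yes _    | no φ≢ψ   = no λ { refl → φ≢ψ refl }
var _     ≟ᶠ (¬ᶠ _)    = no λ ()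
var _     ≟ᶠ (_ ∧ᶠ _)  = no λ ()
var _     ≟ᶠ ([ _ ] _) = no λ ()
(¬ᶠ _)    ≟ᶠ var _     = no λ ()
(¬ᶠ _)    ≟ᶠ (_ ∧ᶠ _)  = no λ ()
(¬ᶠ _)    ≟ᶠ ([ _ ] _) = no λ ()
(_ ∧ᶠ _)  ≟ᶠ var _     = no λ ()
(_ ∧ᶠ _)  ≟ᶠ (¬ᶠ _)    = no λ ()
(_ ∧ᶠ _)  ≟ᶠ ([ _ ] _) = no λ ()
([ _ ] _) ≟ᶠ var _     = no λ ()
([ _ ] _) ≟ᶠ (¬ᶠ _)    = no λ ()
([ _ ] _) ≟ᶠ (_ ∧ᶠ _)  = no λ ()

module _ {n : ℕ} where

  infix 4 _⊨_

  -- The connectives are read as Agda's own, so a tautological consequence is an ordinary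
  -- λ-term; the one classical principle needed is ⊨-stable.
  _⊨_ : (Formula n → Bool) → Formula n → Set
  v ⊨ var p     = T (v (var p))
  v ⊨ ¬ᶠ φ      = ¬ v ⊨ φ
  v ⊨ φ ∧ᶠ ψ    = v ⊨ φ × v ⊨ ψ
  v ⊨ [ G ] φ   = T (v ([ G ] φ))

  module _ (v : Formula n → Bool) where

    ⊨⇔T-eval : ∀ φ → v ⊨ φ ⇔ T (eval v φ)
    ⊨⇔T-eval (var p)   = mk⇔ id id
    ⊨⇔T-eval ([ G ] φ) = mk⇔ id id
    ⊨⇔T-eval (¬ᶠ φ)    = mk⇔ (λ ⊭φ → from (T-not (eval v φ)) (⊭φ ∘ from (⊨⇔T-eval φ)))
                             (λ T¬φ → to (T-not (eval v φ)) T¬φ ∘ to (⊨⇔T-eval φ))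
    ⊨⇔T-eval (φ ∧ᶠ ψ)  = ⇔.trans (⊨⇔T-eval φ ×-⇔ ⊨⇔T-eval ψ) (⇔.sym T-∧)

    ⊭⊥ : ¬ v ⊨ ⊥ᶠ
    ⊭⊥ (⊨p , ⊭p) = ⊭p ⊨p

    ⊨-stable : ∀ φ → ¬ ¬ v ⊨ φ → v ⊨ φ
    ⊨-stable φ ¬¬φ =
      from (⊨⇔T-eval φ) (decidable-stable (T? (eval v φ)) (¬¬φ ∘ (_∘ to (⊨⇔T-eval φ))))

    ⊨⇒-elim : ∀ φ ψ → v ⊨ φ ⇒ ψ → v ⊨ φ → v ⊨ ψ
    ⊨⇒-elim φ ψ ⊨φ⇒ψ ⊨φ = ⊨-stable ψ λ ⊭ψ → ⊨φ⇒ψ (⊨φ , ⊭ψ)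

    ⊨⋀ : ∀ Φ → v ⊨ ⋀ Φ ⇔ All (v ⊨_) Φ
    ⊨⋀ []      = mk⇔ (λ _ → []) (λ _ → ⊭⊥)
    ⊨⋀ (φ ∷ Φ) = ⇔.trans (⇔.refl ×-⇔ ⊨⋀ Φ) (mk⇔ (λ (⊨φ , ⊨Φ) → ⊨φ ∷ ⊨Φ) All.uncons)

  tautology : ∀ {φ} → (∀ v → v ⊨ φ) → ⊢ φ
  tautology {φ} ⊨φ = taut λ v → to T-≡ (to (⊨⇔T-eval v φ) (⊨φ v))

  ⊢-consequence₁ : ∀ {φ ψ} → (∀ v → v ⊨ φ → v ⊨ ψ) → ⊢ φ → ⊢ ψ
  ⊢-consequence₁ φ⊨ψ = mp (tautology λ v (⊨φ , ⊭ψ) → ⊭ψ (φ⊨ψ v ⊨φ))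

  ⊢-consequence₂ : ∀ {φ ψ χ} → (∀ v → v ⊨ φ → v ⊨ ψ → v ⊨ χ) → ⊢ φ → ⊢ ψ → ⊢ χ
  ⊢-consequence₂ φψ⊨χ ⊢φ = mp (mp (tautology λ v (⊨φ , ⊭ψ⇒χ) → ⊭ψ⇒χ λ (⊨ψ , ⊭χ) →
    ⊭χ (φψ⊨χ v ⊨φ ⊨ψ)) ⊢φ)

module _ {n : ℕ} where

  insert : Formula n → FSet n → FSet n
  insert φ Γ ψ = Γ ψ ∨ ⌊ ψ ≟ᶠ φ ⌋

  ⊆-insert : ∀ {φ Γ} → Γ ⊆ᶠ insert φ Γ
  ⊆-insert ψ ψ∈Γ rewrite ψ∈Γ = refl

  ∈-insert : ∀ {φ Γ} → φ ∈ᶠ insert φ Γ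
  ∈-insert {φ} {Γ} rewrite ⌊⌋-true (φ ≟ᶠ φ) refl = ∨-zeroʳ (Γ φ)

  ∈-insert⁻ : ∀ {φ Γ ψ} → ψ ∈ᶠ insert φ Γ → ψ ∈ᶠ Γ ⊎ ψ ≡ φ
  ∈-insert⁻ {φ} {Γ} {ψ} ψ∈Γ,φ with Γ ψ | ψ ≟ᶠ φ
  ... | true  | _        = inj₁ refl
  ... | false | yes ψ≡φ = inj₂ ψ≡φ

  module _ {Γ : FSet n} where

    ⊢ˢ-∈ : ∀ {φ} → φ ∈ᶠ Γ → Γ ⊢ˢ φ
    ⊢ˢ-∈ {φ} φ∈Γ = φ ∷ [] , φ∈Γ ∷ [] , tautology λ v ((⊨φ , _) , ⊭φ) → ⊭φ ⊨φ

    ⊢ˢ-theorem : ∀ {φ} → ⊢ φ → Γ ⊢ˢ φ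
    ⊢ˢ-theorem ⊢φ = [] , [] , ⊢-consequence₁ (λ v ⊨φ (_ , ⊭φ) → ⊭φ ⊨φ) ⊢φ

    ⊢ˢ-consequence₁ : ∀ {φ ψ} → (∀ v → v ⊨ φ → v ⊨ ψ) → Γ ⊢ˢ φ → Γ ⊢ˢ ψ
    ⊢ˢ-consequence₁ {φ} {ψ} φ⊨ψ (Φ , Φ⊆Γ , ⊢Φ⇒φ) = Φ , Φ⊆Γ , ⊢-consequence₁ Φ⇒φ⊨Φ⇒ψ ⊢Φ⇒φ
      where
      Φ⇒φ⊨Φ⇒ψ : ∀ v → v ⊨ ⋀ Φ ⇒ φ → v ⊨ ⋀ Φ ⇒ ψ
      Φ⇒φ⊨Φ⇒ψ v ⊨Φ⇒φ (⊨Φ , ⊭ψ) = ⊭ψ (φ⊨ψ v (⊨⇒-elim v (⋀ Φ) φ ⊨Φ⇒φ ⊨Φ))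

    ⊢ˢ-consequence₂ : ∀ {φ ψ χ} → (∀ v → v ⊨ φ → v ⊨ ψ → v ⊨ χ) → Γ ⊢ˢ φ → Γ ⊢ˢ ψ → Γ ⊢ˢ χ
    ⊢ˢ-consequence₂ {φ} {ψ} {χ} φψ⊨χ (Φ , Φ⊆Γ , ⊢Φ⇒φ) (Ψ , Ψ⊆Γ , ⊢Ψ⇒ψ) =
      Φ ++ Ψ , All.++⁺ Φ⊆Γ Ψ⊆Γ , ⊢-consequence₂ merge ⊢Φ⇒φ ⊢Ψ⇒ψ
      where
      merge : ∀ v → v ⊨ ⋀ Φ ⇒ φ → v ⊨ ⋀ Ψ ⇒ ψ → v ⊨ ⋀ (Φ ++ Ψ) ⇒ χ
      merge v ⊨Φ⇒φ ⊨Ψ⇒ψ (⊨ΦΨ , ⊭χ) =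
        let ⊨Φ , ⊨Ψ = All.++⁻ Φ (to (⊨⋀ v (Φ ++ Ψ)) ⊨ΦΨ) in
        ⊭χ (φψ⊨χ v (⊨⇒-elim v (⋀ Φ) φ ⊨Φ⇒φ (from (⊨⋀ v Φ) ⊨Φ))
                   (⊨⇒-elim v (⋀ Ψ) ψ ⊨Ψ⇒ψ (from (⊨⋀ v Ψ) ⊨Ψ)))

    discharge : ∀ {φ Φ} → All (_∈ᶠ insert φ Γ) Φ →
                ∃[ Ψ ] (All (_∈ᶠ Γ) Ψ × (∀ v → All (v ⊨_) Ψ → v ⊨ φ → All (v ⊨_) Φ))
    discharge []             = [] , [] , λ _ _ _ → []
    discharge {φ} {ψ ∷ _} (ψ∈Γ,φ ∷ Φ⊆Γ,φ) with discharge Φ⊆Γ,φ | ∈-insert⁻ {φ} {Γ} {ψ} ψ∈Γ,φ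
    ... | Ψ , Ψ⊆Γ , Ψφ⊨Φ | inj₁ ψ∈Γ =
      ψ ∷ Ψ , ψ∈Γ ∷ Ψ⊆Γ , λ { v (⊨ψ ∷ ⊨Ψ) ⊨φ → ⊨ψ ∷ Ψφ⊨Φ v ⊨Ψ ⊨φ }
    ... | Ψ , Ψ⊆Γ , Ψφ⊨Φ | inj₂ refl =
      Ψ , Ψ⊆Γ , λ v ⊨Ψ ⊨φ → ⊨φ ∷ Ψφ⊨Φ v ⊨Ψ ⊨φ

    ⊢ˢ-deduction : ∀ {φ ψ} → insert φ Γ ⊢ˢ ψ → Γ ⊢ˢ (φ ⇒ ψ)
    ⊢ˢ-deduction {φ} {ψ} (Φ , Φ⊆Γ,φ , ⊢Φ⇒ψ) with discharge Φ⊆Γ,φ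
    ... | Ψ , Ψ⊆Γ , Ψφ⊨Φ = Ψ , Ψ⊆Γ , ⊢-consequence₁ curry ⊢Φ⇒ψ
      where
      curry : ∀ v → v ⊨ ⋀ Φ ⇒ ψ → v ⊨ ⋀ Ψ ⇒ (φ ⇒ ψ)
      curry v ⊨Φ⇒ψ (⊨Ψ , ⊭φ⇒ψ) = ⊭φ⇒ψ λ (⊨φ , ⊭ψ) →
        ⊭ψ (⊨⇒-elim v (⋀ Φ) ψ ⊨Φ⇒ψ (from (⊨⋀ v Φ) (Ψφ⊨Φ v (to (⊨⋀ v Ψ) ⊨Ψ) ⊨φ)))

module MaxConsistentSet {n : ℕ} {Γ : FSet n} (mc : MaxConsistent Γ) where

  ⊥∉ : ¬ ⊥ᶠ ∈ᶠ Γ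
  ⊥∉ = proj₁ mc ∘ ⊢ˢ-∈

  ∈-stable : ∀ {φ} → ¬ ¬ φ ∈ᶠ Γ → φ ∈ᶠ Γ
  ∈-stable {φ} = decidable-stable (Γ φ ≟ᵇ true)

  -- Maximality is a negative property, so it only refutes the consistency of insert φ Γ;
  -- membership is Boolean and thus ¬¬-stable, which is enough to conclude.
  refute : ∀ {φ} → ¬ φ ∈ᶠ Γ → ¬ ¬ Γ ⊢ˢ ¬ᶠ φ
  refute {φ} φ∉Γ ⊬¬φ = proj₂ mc (insert φ Γ) ⊆-insert consistent (φ , ∈-insert {Γ = Γ} , φ∉Γ)
    where
    consistent : Consistent (insert φ Γ)
    consistent = ⊬¬φ ∘ ⊢ˢ-consequence₁ (λ v ⊨φ⇒⊥ ⊨φ → ⊨φ⇒⊥ (⊨φ , ⊭⊥ v)) ∘ ⊢ˢ-deduction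

  closed : ∀ {φ} → Γ ⊢ˢ φ → φ ∈ᶠ Γ
  closed ⊢φ = ∈-stable λ φ∉Γ → refute φ∉Γ λ ⊢¬φ →
    proj₁ mc (⊢ˢ-consequence₂ (λ v ⊨φ ⊭φ → ⊥-elim (⊭φ ⊨φ)) ⊢φ ⊢¬φ)

  ∈-¬ : ∀ {φ} → ¬ φ ∈ᶠ Γ → ¬ᶠ φ ∈ᶠ Γ
  ∈-¬ φ∉Γ = ∈-stable λ ¬φ∉Γ → refute φ∉Γ (¬φ∉Γ ∘ closed)

  ∈-consequence₂ : ∀ {φ ψ χ} → (∀ v → v ⊨ φ → v ⊨ ψ → v ⊨ χ) → φ ∈ᶠ Γ → ψ ∈ᶠ Γ → χ ∈ᶠ Γ
  ∈-consequence₂ φψ⊨χ φ∈Γ ψ∈Γ = closed (⊢ˢ-consequence₂ φψ⊨χ (⊢ˢ-∈ φ∈Γ) (⊢ˢ-∈ ψ∈Γ))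

  ∉-¬ : ∀ {φ} → ¬ᶠ φ ∈ᶠ Γ → ¬ φ ∈ᶠ Γ
  ∉-¬ ¬φ∈Γ = ⊥∉ ∘ ∈-consequence₂ (λ v ⊭φ ⊨φ → ⊥-elim (⊭φ ⊨φ)) ¬φ∈Γ

  ∈-mp : ∀ {φ ψ} → (φ ⇒ ψ) ∈ᶠ Γ → φ ∈ᶠ Γ → ψ ∈ᶠ Γ
  ∈-mp {φ} {ψ} = ∈-consequence₂ λ v → ⊨⇒-elim v φ ψ

  ∈-∧ : ∀ {φ ψ} → φ ∈ᶠ Γ → ψ ∈ᶠ Γ → (φ ∧ᶠ ψ) ∈ᶠ Γ
  ∈-∧ = ∈-consequence₂ λ v → _,_

  ∈-theorem : ∀ {φ} → ⊢ φ → φ ∈ᶠ Γ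
  ∈-theorem = closed ∘ ⊢ˢ-theorem

  ∈-⊢⇒ : ∀ {φ ψ} → ⊢ (φ ⇒ ψ) → φ ∈ᶠ Γ → ψ ∈ᶠ Γ
  ∈-⊢⇒ = ∈-mp ∘ ∈-theorem

  ∈-⋀ : ∀ {Φ} → All (_∈ᶠ Γ) Φ → ⋀ Φ ∈ᶠ Γ
  ∈-⋀ {Φ} Φ⊆Γ = closed (Φ , Φ⊆Γ , tautology λ v (⊨Φ , ⊭Φ) → ⊭Φ ⊨Φ)

  ∈-⋁ : ∀ Φ → ⋁ Φ ∈ᶠ Γ → Any (_∈ᶠ Γ) Φ
  ∈-⋁ []      ⊥∈Γ = ⊥-elim (⊥∉ ⊥∈Γ)
  ∈-⋁ (φ ∷ Φ) φ∨Φ∈Γ with Γ φ ≟ᵇ true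
  ... | yes φ∈Γ = here φ∈Γ
  ... | no  φ∉Γ = there (∈-⋁ Φ (∈-mp φ∨Φ∈Γ (∈-¬ φ∉Γ)))

lookupT-tabT : ∀ {n} (f : Subset n → Bool) B → lookupT (tabT f) B ≡ f B
lookupT-tabT {zero}  f []          = refl
lookupT-tabT {suc n} f (false ∷ B) = lookupT-tabT (λ C → f (false ∷ C)) B
lookupT-tabT {suc n} f (true ∷ B)  = lookupT-tabT (λ C → f (true ∷ C)) B

∈ᴾ⇒Nonempty : ∀ {n} (G : Pattern n) {B} → B ∈ᴾ G → Nonempty B
∈ᴾ⇒Nonempty {zero}  tt      {[]}        ()
∈ᴾ⇒Nonempty {suc n} (G , _) {false ∷ B} B∈G = let i , i∈B = ∈ᴾ⇒Nonempty G B∈G in suc i , thereᵛ i∈B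
∈ᴾ⇒Nonempty {suc n} _       {true ∷ B}  _   = zero , hereᵛ

memP-tabP : ∀ {n} (f : Subset n → Bool) {B} → Nonempty B → memP (tabP f) B ≡ f B
memP-tabP {zero}  f {[]}        (() , _)
memP-tabP {suc n} f {false ∷ B} (zero , ())
memP-tabP {suc n} f {false ∷ B} (suc i , thereᵛ i∈B) = memP-tabP (λ C → f (false ∷ C)) (i , i∈B)
memP-tabP {suc n} f {true ∷ B}  _                    = lookupT-tabT (λ C → f (true ∷ C)) B

∈-allSub : ∀ {n} (B : Subset n) → B ∈ allSub n
∈-allSub {zero}  []          = here refl
∈-allSub {suc n} (false ∷ B) = ∈-++⁺ˡ (∈-map⁺ (false ∷_) (∈-allSub B))
∈-allSub {suc n} (true ∷ B)  = ∈-++⁺ʳ (map (false ∷_) (allSub n)) (∈-map⁺ (true ∷_) (∈-allSub B))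

module _ {n : ℕ} where

  ∈-∪ᴾˡ : ∀ {G H : Pattern n} {B} → B ∈ᴾ G → B ∈ᴾ (G ∪ᴾ H)
  ∈-∪ᴾˡ {G} {H} {B} B∈G
    rewrite memP-tabP (λ C → memP G C ∨ memP H C) (∈ᴾ⇒Nonempty G B∈G) | B∈G = refl

  ∈-∪ᴾʳ : ∀ {G H : Pattern n} {B} → B ∈ᴾ H → B ∈ᴾ (G ∪ᴾ H)
  ∈-∪ᴾʳ {G} {H} {B} B∈H
    rewrite memP-tabP (λ C → memP G C ∨ memP H C) (∈ᴾ⇒Nonempty H B∈H) | B∈H = ∨-zeroʳ (memP G B)

  ∈-sing : ∀ {B : Subset n} → Nonempty B → B ∈ᴾ sing B
  ∈-sing {B} B≢∅ = trans (memP-tabP (_==ˢ B) B≢∅) (⌊⌋-true (≡-dec _≟ᵇ_ B B) refl)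

  compl-disjoint : ∀ (P : Pattern n) {B} → B ∈ᴾ P → ¬ B ∈ᴾ compl P
  compl-disjoint P {B} B∈P B∈Pᶜ = to (T-not _) (from T-≡ uncovered) (from T-≡ covered)
    where
    covered : foldr (λ C b → (memP P C ∧ (B ⊆ᵇ C)) ∨ b) false (allSub n) ≡ true
    covered = foldr-∨-true _ (∈-allSub B) (trans (cong (_∧ (B ⊆ᵇ B)) B∈P) (⌊⌋-true (B ⊆? B) ⊆-refl))
    uncovered : not (foldr (λ C b → (memP P C ∧ (B ⊆ᵇ C)) ∨ b) false (allSub n)) ≡ true
    uncovered = trans (sym (memP-tabP _ (∈ᴾ⇒Nonempty P B∈P))) B∈Pᶜ

  ∈-elems : ∀ {G : Pattern n} {B} → B ∈ᴾ G → B ∈ elems G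
  ∈-elems {G} {B} B∈G = ∈-filter⁺ (T? ∘ memP G) (∈-allSub B) (from T-≡ B∈G)

  elems-⊆ : ∀ (G : Pattern n) → All (_∈ᴾ G) (elems G)
  elems-⊆ G = All.map (to T-≡) (All.all-filter (T? ∘ memP G) (allSub n))

module _ {n : ℕ} {M : Frame n} where

  Equiv-sym : IsPreModel M → ∀ w v → Equiv M w v → Equiv M v w
  Equiv-sym pre _ _ (P , P=w̄ , P=v̄ , w∼v) = P , P=v̄ , P=w̄ , IsPreModel.sym pre P w∼v

  bar-compl-dead : ∀ {P} w {B} → IsBar M P w → B ∈ᴾ compl P → ¬ Alive M (sing B) w
  bar-compl-dead {P} _ {B} P=w̄ B∈Pᶜ alive =
    compl-disjoint P (proj₂ (P=w̄ B) (sing B , ∈-sing (∈ᴾ⇒Nonempty (compl P) B∈Pᶜ) , alive)) B∈Pᶜ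

  module _ (κ : IsKappaModel M) where
    open IsKappaModel κ

    join-alive : ∀ w {Bs} → All (λ B → ∃[ G ] (B ∈ᴾ G × Alive M G w)) Bs →
                 ∃[ Q ] (Alive M Q w × All (_∈ᴾ Q) Bs)
    join-alive w [] = let G , G-alive = NE w in G , G-alive , []
    join-alive w ((G , B∈G , G-alive) ∷ witnesses) =
      let Q , Q-alive , Bs⊆Q = join-alive w witnesses in
      G ∪ᴾ Q , K1 G Q w G-alive Q-alive , ∈-∪ᴾˡ {H = Q} B∈G ∷ All.map (∈-∪ᴾʳ {G = G}) Bs⊆Q

    bar-alive : ∀ {P} w → IsBar M P w → Alive M P w
    bar-alive {P} w P=w̄ =
      let Q , Q-alive , P⊆Q = join-alive w (All.map (proj₁ (P=w̄ _)) (elems-⊆ P)) in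
      K3 P Q (λ B B∈P → All.lookup P⊆Q (∈-elems B∈P)) w w Q-alive

module Canonical (n : ℕ) where
  open MaxConsistentSet

  M : Frame n
  M = canonical n

  open Frame M

  alive∈⇒Alive : ∀ {G Γ} (mc : MaxConsistent Γ) → alive G ∈ᶠ Γ → Alive M G (Γ , mc)
  alive∈⇒Alive mc alive∈ φ □φ∈ = ∈-mp mc (∈-⊢⇒ mc axT alive∈) □φ∈

  Alive⇒alive∈ : ∀ {G Γ} (mc : MaxConsistent Γ) → Alive M G (Γ , mc) → alive G ∈ᶠ Γ
  Alive⇒alive∈ mc Γ∼Γ = ∈-¬ mc (⊥∉ mc ∘ Γ∼Γ ⊥ᶠ)

  ∼-sym : ∀ G {w v} → R G w v → R G v w
  ∼-sym G {_ , Γmc} {_ , Δmc} w∼v φ □φ∈Δ = ∈-stable Γmc λ φ∉Γ →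
    ∉-¬ Δmc (w∼v _ (∈-⊢⇒ Γmc axB (∈-¬ Γmc φ∉Γ))) (∈-⊢⇒ Δmc (mp axK (nec ⊢φ⇒¬¬φ)) □φ∈Δ)
    where
    ⊢φ⇒¬¬φ : ⊢ (φ ⇒ ¬ᶠ ¬ᶠ φ)
    ⊢φ⇒¬¬φ = tautology λ v (⊨φ , ⊭¬¬φ) → ⊭¬¬φ λ ⊭φ → ⊭φ ⊨φ

  ∼-trans : ∀ G {w v u} → R G w v → R G v u → R G w u
  ∼-trans G {_ , Γmc} w∼v v∼u φ □φ∈Γ = v∼u φ (w∼v _ (∈-⊢⇒ Γmc ax4 □φ∈Γ))

  ∼-antitone : ∀ {G H} → (∀ {φ} → ⊢ ([ G ] φ ⇒ [ H ] φ)) → ∀ w v → R H w v → R G w v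
  ∼-antitone ⊢□G⇒□H (_ , mc) v w∼v φ □φ∈ = w∼v φ (∈-⊢⇒ mc ⊢□G⇒□H □φ∈)

  some-Alive : ∀ w → ∃[ G ] Alive M G w
  some-Alive (_ , mc) =
    let G , alive∈ = satisfied (Any.map⁻ (∈-⋁ mc (map alive (allPat n)) (∈-theorem mc axNE)))
    in G , alive∈⇒Alive mc alive∈

  isKappaModel : IsKappaModel M
  isKappaModel = record
    { preModel = record { sym = ∼-sym ; trans = ∼-trans }
    ; K1 = λ { G H (_ , mc) G-alive H-alive → alive∈⇒Alive mc (∈-⊢⇒ mc axUnion
                 (∈-∧ mc (Alive⇒alive∈ mc G-alive) (Alive⇒alive∈ mc H-alive))) }
    ; K2 = λ { G A B A∈G B∈G (_ , mc) G-alive →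
                 alive∈⇒Alive mc (∈-⊢⇒ mc (axClo A∈G B∈G) (Alive⇒alive∈ mc G-alive)) }
    ; K3 = λ G H G⊆H → ∼-antitone (axMono G⊆H)
    ; K4 = λ G A B A∈G B≢∅ B⊆A → ∼-antitone (axEquiv A∈G B≢∅ B⊆A)
    ; NE = some-Alive
    }

  bar-dead∈ : ∀ {P Γ} (mc : MaxConsistent Γ) → IsBar M P (Γ , mc) → dead (compl P) ∈ᶠ Γ
  bar-dead∈ {P} {Γ} mc P=w̄ = ∈-⋀ mc (All.map⁺ (All.map dead∈ (elems-⊆ (compl P))))
    where
    dead∈ : ∀ {B} → B ∈ᴾ compl P → (¬ᶠ alive (sing B)) ∈ᶠ Γ
    dead∈ B∈Pᶜ = ∈-¬ mc (bar-compl-dead {M = M} (Γ , mc) P=w̄ B∈Pᶜ ∘ alive∈⇒Alive mc)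

  Equiv⇒⊆ : ∀ w v → Equiv M w v → proj₁ w ⊆ᶠ proj₁ v
  Equiv⇒⊆ w@(Γ , Γmc) (_ , Δmc) (P , P=w̄ , P=v̄ , w∼v) φ φ∈Γ =
    ∈-mp Δmc (w∼v (dead (compl P) ⇒ φ) □⟨dead⇒φ⟩∈Γ) (bar-dead∈ Δmc P=v̄)
    where
    P-alive : alive P ∈ᶠ Γ
    P-alive = Alive⇒alive∈ Γmc (bar-alive isKappaModel w P=w̄)
    □⟨dead⇒φ⟩∈Γ : ([ P ] (dead (compl P) ⇒ φ)) ∈ᶠ Γ
    □⟨dead⇒φ⟩∈Γ = ∈-⊢⇒ Γmc axP (∈-∧ Γmc P-alive (∈-∧ Γmc (bar-dead∈ Γmc P=w̄) φ∈Γ))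

  isProper : IsProper M
  isProper w v w≡v φ = ⇔→≡ (mk⇔ (Equiv⇒⊆ w v w≡v φ) (Equiv⇒⊆ v w v≡w φ))
    where
    v≡w : Equiv M v w
    v≡w = Equiv-sym (IsKappaModel.preModel isKappaModel) w v w≡v

theorem5p45 : (n : ℕ) → IsKappaModel (canonical n) × IsProper (canonical n)
theorem5p45 n = Canonical.isKappaModel n , Canonical.isProper n
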